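{- If a graph $G$ is $123$-representable, then (for a suitable labeling of its vertices by distinct elements of a totally ordered set) there exists a $123$-avoiding word $w$ representing $G$ in which every letter appears at most twice.
   Context: All graphs are simple. A word is a finite sequence of letters from a totally ordered alphabet. Two letters $x,y$ alternate in a word $w$ if between any two occurrences of $x$ there is an occurrence of $y$ and between any two occurrences of $y$ there is an occurrence of $x$. A graph $G=(V,E)$ is represented by a word $w$ over $V$ if for all distinct $x,y\in V$, $x$ and $y$ alternate in $w$ if and only if $xy\in E$. A word is $123$-avoiding if it has no strictly increasing subsequence of length $3$. A graph is $123$-representable if, after labeling its vertices by distinct elements of a totally ordered set (any labeling may be chosen), it is represented by a $123$-avoiding word. -}

module Defs where

open import Data.Nat using (ℕ; _<_; _≤_)
open import Data.Fin using (Fin)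
open import Data.Fin.Properties using (_≟_)
open import Data.List using (List; length; lookup; filter)
open import Data.List.Membership.Propositional using (_∈_)
open import Data.Product using (Σ; _×_; ∃; ∃-syntax)
open import Relation.Nullary using (¬_)
open import Relation.Binary.PropositionalEquality using (_≡_; _≢_)
open import Function.Definitions using (Injective)

record SimpleGraph (n : ℕ) : Set₁ where
  field
    Adj   : Fin n → Fin n → Set
    sym   : ∀ {x y} → Adj x y → Adj y x
    irrefl : ∀ {x} → ¬ Adj x x
open SimpleGraph public

Word : ℕ → Set
Word n = List (Fin n)

Pos : ∀ {n} → Word n → Set
Pos w = Fin (length w)

Between : ∀ {n} (w : Word n) (x y : Fin n) → Set
Between w x y = (i j : Pos w) → Data.Fin._<_ i j → lookup w i ≡ x → lookup w j ≡ x →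
  ∃[ k ] (Data.Fin._<_ i k × Data.Fin._<_ k j × lookup w k ≡ y)

Alternate : ∀ {n} (w : Word n) (x y : Fin n) → Set
Alternate w x y = Between w x y × Between w y x

Represents : ∀ {n} → SimpleGraph n → Word n → Set
Represents {n} G w =
  ((x : Fin n) → x ∈ w) ×
  ((x y : Fin n) → x ≢ y → (Alternate w x y → Adj G x y) × (Adj G x y → Alternate w x y))

Labeling : ℕ → Set
Labeling n = Σ (Fin n → ℕ) Injective'
  where Injective' : (Fin n → ℕ) → Set
        Injective' f = Injective _≡_ _≡_ f

Avoids123 : ∀ {n} → (Fin n → ℕ) → Word n → Set
Avoids123 ℓ w = ¬ (∃[ i ] ∃[ j ] ∃[ k ]
  (Data.Fin._<_ i j × Data.Fin._<_ j k ×
   ℓ (lookup w i) < ℓ (lookup w j) × ℓ (lookup w j) < ℓ (lookup w k)))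

count : ∀ {n} → Fin n → Word n → ℕ
count x w = length (filter (_≟ x) w)

Is123Representable : ∀ {n} → SimpleGraph n → Set
Is123Representable {n} G =
  Σ (Labeling n) λ ℓ → ∃[ w ] (Represents G w × Avoids123 (Data.Product.proj₁ ℓ) w)

-- While some letter x
-- occurs at least three times we replace w by a strictly shorter word that still represents G
-- and avoids 123; well-founded induction on the length finishes the proof.  The key fact is
-- the three-occurrence lemma: a letter y alternating with x occurs between the first and the
-- second and between the second and the third x, so two such letters would form a 123 with
-- one of these x's.  Hence x alternates with at most one letter y, and:
--   (A) if x alternates with nothing, erase all x's and put x x at the first one;
--   (B) if its partner y occurs at most twice, erase all x's and replace one y by x y x;
--   (C) otherwise x and y are each other's only partners: erase both and put x y x y.

module Submission where

open import Defs hiding (sym)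
open import Data.Empty using (⊥-elim)
open import Data.Fin as Fin using (Fin; zero; suc)
open import Data.Fin.Properties using (_≟_; any?)
open import Data.List using ([]; _∷_; _++_; length; lookup; filter)
open import Data.List.Properties using (++-assoc; length-++; filter-++)
open import Data.List.Membership.Propositional using (_∈_; find; lose)
open import Data.List.Membership.Propositional.Properties using (∈-++⁺ˡ; ∈-++⁺ʳ; ∈-++⁻; ∈-∃++; ∈-lookup)
open import Data.List.Relation.Unary.Any using (Any; here; there; index)
import Data.List.Relation.Unary.Any.Properties as Any
open import Data.List.Relation.Binary.Sublist.Propositional
  using (_⊆_; []; _∷_; _∷ʳ_; ⊆-trans; from∈; to∈; minimum)
open import Data.List.Relation.Binary.Sublist.Propositional.Properties using (++⁺; ++⁺ˡ; ++⁺ʳ; ∷ˡ⁻)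
open import Data.Maybe using (Maybe; just; nothing)
open import Data.Nat using (ℕ; suc; _+_; _≤_; _<_; z≤n; s≤s; s≤s⁻¹; _≤?_)
open import Data.Nat.Induction using (<-wellFounded)
open import Data.Nat.Properties
  using ( ≤-trans; ≤-reflexive; +-suc; +-assoc; +-comm; +-monoʳ-≤; +-monoˡ-≤; +-mono-≤; +-monoʳ-<
        ; n<1+n; m≤m+n; m≤n+m; n≤1+n; ≰⇒>; <-cmp; <-irrefl; <-asym; n≤0⇒n≡0; 1+n≢0
        ; +-commutativeSemigroup; module ≤-Reasoning )
open import Algebra.Properties.CommutativeSemigroup +-commutativeSemigroup using (interchange)
open import Data.Product using (Σ; _×_; _,_; proj₁; proj₂; swap; ∃-syntax)
open import Data.Sum using (_⊎_; inj₁; inj₂)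
open import Function using (case_of_)
open import Function.Definitions using (Injective)
open import Induction.WellFounded using (Acc; acc)
open import Relation.Binary using (tri<; tri≈; tri>)
open import Relation.Binary.PropositionalEquality
open import Relation.Nullary using (¬_; Dec; yes; no; ¬?)
open import Relation.Nullary.Decidable using (map′; _×-dec_)

module _ {n : ℕ} where

  count-here : ∀ (x : Fin n) w → count x (x ∷ w) ≡ suc (count x w)
  count-here x w with x ≟ x
  ... | yes _ = refl
  ... | no x≢x = ⊥-elim (x≢x refl)

  count-there : ∀ {c x : Fin n} w → c ≢ x → count x (c ∷ w) ≡ count x w
  count-there {c} {x} w c≢x with c ≟ x
  ... | yes c≡x = ⊥-elim (c≢x c≡x)
  ... | no _ = refl

  count-++ : ∀ (x : Fin n) u v → count x (u ++ v) ≡ count x u + count x v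
  count-++ x u v = trans (cong length (filter-++ (_≟ x) u v)) (length-++ (filter (_≟ x) u))

  erase : Fin n → Word n → Word n
  erase z [] = []
  erase z (c ∷ w) with c ≟ z
  ... | yes _ = erase z w
  ... | no _ = c ∷ erase z w

  erase-here : ∀ z w → erase z (z ∷ w) ≡ erase z w
  erase-here z w with z ≟ z
  ... | yes _ = refl
  ... | no z≢z = ⊥-elim (z≢z refl)

  erase-there : ∀ {c z} w → c ≢ z → erase z (c ∷ w) ≡ c ∷ erase z w
  erase-there {c} {z} w c≢z with c ≟ z
  ... | yes c≡z = ⊥-elim (c≢z c≡z)
  ... | no _ = refl

  erase-++ : ∀ z u v → erase z (u ++ v) ≡ erase z u ++ erase z v
  erase-++ z [] v = refl
  erase-++ z (c ∷ u) v with c ≟ z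
  ... | yes _ = erase-++ z u v
  ... | no _ = cong (c ∷_) (erase-++ z u v)

  erase-⊆ : ∀ z w → erase z w ⊆ w
  erase-⊆ z [] = []
  erase-⊆ z (c ∷ w) with c ≟ z
  ... | yes _ = c ∷ʳ erase-⊆ z w
  ... | no _ = refl ∷ erase-⊆ z w

  count-erase-self : ∀ z w → count z (erase z w) ≡ 0
  count-erase-self z [] = refl
  count-erase-self z (c ∷ w) with c ≟ z
  ... | yes _ = count-erase-self z w
  ... | no c≢z = trans (count-there (erase z w) c≢z) (count-erase-self z w)

  count-erase-other : ∀ {t} z w → t ≢ z → count t (erase z w) ≡ count t w
  count-erase-other z [] _ = refl
  count-erase-other {t} z (c ∷ w) t≢z with c ≟ z
  ... | yes refl = trans (count-erase-other z w t≢z) (sym (count-there w (λ c≡t → t≢z (sym c≡t))))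
  ... | no _ with c ≟ t
  ...   | yes _ = cong suc (count-erase-other z w t≢z)
  ...   | no _ = count-erase-other z w t≢z

  erase-fresh : ∀ z w → count z w ≡ 0 → erase z w ≡ w
  erase-fresh z [] _ = refl
  erase-fresh z (c ∷ w) h with c ≟ z
  erase-fresh z (c ∷ w) () | yes _
  ... | no _ = cong (c ∷_) (erase-fresh z w h)

  length-erase : ∀ z w → length (erase z w) + count z w ≡ length w
  length-erase z [] = refl
  length-erase z (c ∷ w) with c ≟ z
  ... | yes refl = trans (+-suc _ _) (cong suc (length-erase c w))
  ... | no _ = cong suc (length-erase z w)

  ∈-erase : ∀ {t} z w → t ≢ z → t ∈ w → t ∈ erase z w
  ∈-erase z (c ∷ w) t≢z (here refl) rewrite erase-there w t≢z = here refl
  ∈-erase z (c ∷ w) t≢z (there t∈w) with c ≟ z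
  ... | yes _ = ∈-erase z w t≢z t∈w
  ... | no _ = there (∈-erase z w t≢z t∈w)

  first-occurrence : ∀ (x : Fin n) w → 1 ≤ count x w →
    ∃[ u ] ∃[ v ] (w ≡ u ++ x ∷ v × suc (count x v) ≡ count x w)
  first-occurrence x (c ∷ w) h with c ≟ x
  ... | yes refl = [] , w , refl , refl
  ... | no _ with first-occurrence x w h
  ...   | u , v , refl , e = c ∷ u , v , refl , e

  three-occurrences : ∀ (x : Fin n) w → 3 ≤ count x w →
    ∃[ a₁ ] ∃[ a₂ ] ∃[ a₃ ] ∃[ a₄ ] (w ≡ a₁ ++ x ∷ a₂ ++ x ∷ a₃ ++ x ∷ a₄)
  three-occurrences x w h₃
    with a₁ , r₁ , refl , e₁ ← first-occurrence x w (≤-trans (s≤s z≤n) h₃)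
    with h₂ ← s≤s⁻¹ (subst (3 ≤_) (sym e₁) h₃)
    with a₂ , r₂ , refl , e₂ ← first-occurrence x r₁ (≤-trans (s≤s z≤n) h₂)
    with h₁ ← s≤s⁻¹ (subst (2 ≤_) (sym e₂) h₂)
    with a₃ , a₄ , refl , _ ← first-occurrence x r₂ h₁
    = a₁ , a₂ , a₃ , a₄ , refl

  count-split-other : ∀ (x y : Fin n) → y ≢ x → ∀ u v → count x (u ++ y ∷ v) ≡ count x u + count x v
  count-split-other x y y≢x u v = trans (count-++ x u (y ∷ v)) (cong (count x u +_) (count-there v y≢x))

  count-split-self : ∀ (y : Fin n) u v → count y (u ++ y ∷ v) ≡ suc (count y u + count y v)
  count-split-self y u v = trans (count-++ y u (y ∷ v)) (trans (cong (count y u +_) (count-here y v)) (+-suc _ _))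

  shrink : ∀ (D : Word n → Word n) (c : Word n → ℕ) → (∀ z → length (D z) + c z ≡ length z) →
    ∀ u v m (y : Fin n) → length m ≤ c u + c v → length (D u ++ m ++ D v) < length (u ++ y ∷ v)
  shrink D c removed u v m y short = begin-strict
    length (D u ++ m ++ D v)                     ≡⟨ trans (length-++ (D u)) (cong (length (D u) +_) (length-++ m)) ⟩
    length (D u) + (length m + length (D v))     ≤⟨ +-monoʳ-≤ (length (D u)) (+-monoˡ-≤ (length (D v)) short) ⟩
    length (D u) + ((c u + c v) + length (D v))  ≡⟨ regroup (length (D u)) (c u) (c v) (length (D v)) ⟩
    (length (D u) + c u) + (length (D v) + c v)  ≡⟨ cong₂ _+_ (removed u) (removed v) ⟩
    length u + length v                          <⟨ +-monoʳ-< (length u) (n<1+n (length v)) ⟩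
    length u + suc (length v)                    ≡⟨ sym (length-++ u) ⟩
    length (u ++ y ∷ v)                          ∎
    where
    open ≤-Reasoning
    regroup : ∀ a b c d → a + ((b + c) + d) ≡ (a + b) + (d + c)
    regroup a b c d = begin-equality
      a + ((b + c) + d)   ≡⟨ cong (a +_) (trans (+-assoc b c d) (cong (b +_) (+-comm c d))) ⟩
      a + (b + (d + c))   ≡⟨ sym (+-assoc a b (d + c)) ⟩
      (a + b) + (d + c)   ∎

  length-erase₂ : ∀ (x y : Fin n) → x ≢ y → ∀ w →
    length (erase y (erase x w)) + (count x w + count y w) ≡ length w
  length-erase₂ x y x≢y w = begin
    length (erase y (erase x w)) + (count x w + count y w)
      ≡⟨ cong (λ k → length (erase y (erase x w)) + (count x w + k)) (sym (count-erase-other x w (≢-sym x≢y))) ⟩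
    length (erase y (erase x w)) + (count x w + count y (erase x w))
      ≡⟨ cong (length (erase y (erase x w)) +_) (+-comm (count x w) _) ⟩
    length (erase y (erase x w)) + (count y (erase x w) + count x w)
      ≡⟨ sym (+-assoc (length (erase y (erase x w))) _ _) ⟩
    (length (erase y (erase x w)) + count y (erase x w)) + count x w
      ≡⟨ cong (_+ count x w) (length-erase y (erase x w)) ⟩
    length (erase x w) + count x w
      ≡⟨ length-erase x w ⟩
    length w ∎
    where open ≡-Reasoning

-- The state of a left-to-right scan for the pair (a , b): pending means that an a has
-- been read and no b since.
data State : Set where
  idle pending : State

data Accepted : Maybe State → Set where
  accepted : ∀ {s} → Accepted (just s)

-- A left-to-right scan deciding whether between any two a's there is a b.  It ignores
-- all letters other than a and b, which makes alternation insensitive to erasing them.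
module Scan {n : ℕ} (a b : Fin n) where

  data Role : Set where
    isA isB other : Role

  role : Fin n → Role
  role c with c ≟ a | c ≟ b
  ... | yes _ | _ = isA
  ... | no _ | yes _ = isB
  ... | no _ | no _ = other

  data Spec (c : Fin n) : Role → Set where
    isA : c ≡ a → Spec c isA
    isB : c ≢ a → c ≡ b → Spec c isB
    other : c ≢ a → c ≢ b → Spec c other

  spec : ∀ c → Spec c (role c)
  spec c with c ≟ a | c ≟ b
  ... | yes c≡a | _ = isA c≡a
  ... | no c≢a | yes c≡b = isB c≢a c≡b
  ... | no c≢a | no c≢b = other c≢a c≢b

  step : State → Role → Maybe State
  step s other = just s
  step _ isB = just idle
  step idle isA = just pending
  step pending isA = nothing

  mutual
    scan : State → Word n → Maybe State
    scan s [] = just s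
    scan s (c ∷ w) = resume (step s (role c)) w

    resume : Maybe State → Word n → Maybe State
    resume nothing _ = nothing
    resume (just s) w = scan s w

  scan-++ : ∀ s u v → scan s (u ++ v) ≡ resume (scan s u) v
  scan-++ s [] v = refl
  scan-++ s (c ∷ u) v with step s (role c)
  ... | nothing = refl
  ... | just s′ = scan-++ s′ u v

  scan-a : ∀ s w → scan s (a ∷ w) ≡ resume (step s isA) w
  scan-a s w with role a | spec a
  ... | isA | _ = refl
  ... | isB | isB a≢a _ = ⊥-elim (a≢a refl)
  ... | other | other a≢a _ = ⊥-elim (a≢a refl)

  scan-b : a ≢ b → ∀ s w → scan s (b ∷ w) ≡ scan idle w
  scan-b a≢b s w with role b | spec b
  ... | isA | isA b≡a = ⊥-elim (a≢b (sym b≡a))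
  ... | isB | _ = refl
  ... | other | other _ b≢b = ⊥-elim (b≢b refl)

  scan-other : ∀ {c} → c ≢ a → c ≢ b → ∀ s w → scan s (c ∷ w) ≡ scan s w
  scan-other {c} c≢a c≢b s w with role c | spec c
  ... | isA | isA c≡a = ⊥-elim (c≢a c≡a)
  ... | isB | isB _ c≡b = ⊥-elim (c≢b c≡b)
  ... | other | _ = refl

  scan-erase : ∀ {z} → z ≢ a → z ≢ b → ∀ s w → scan s (erase z w) ≡ scan s w
  scan-erase z≢a z≢b s [] = refl
  scan-erase {z} z≢a z≢b s (c ∷ w) with c ≟ z
  ... | yes refl = trans (scan-erase z≢a z≢b s w) (sym (scan-other z≢a z≢b s w))
  ... | no _ with step s (role c)
  ...   | nothing = refl
  ...   | just s′ = scan-erase z≢a z≢b s′ w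

  Guarded : Word n → Set
  Guarded w = (i : Pos w) → lookup w i ≡ a → ∃[ k ] (k Fin.< i × lookup w k ≡ b)

  -- The property of the rest of the word that a scan in state s checks.
  Valid : State → Word n → Set
  Valid idle w = Between w a b
  Valid pending w = Between w a b × Guarded w

  between-of : ∀ {s w} → Valid s w → Between w a b
  between-of {idle} bt = bt
  between-of {pending} (bt , _) = bt

  between-tail : ∀ {c w} → Between (c ∷ w) a b → Between w a b
  between-tail bt i j i<j ei ej with bt (suc i) (suc j) (s≤s i<j) ei ej
  ... | zero , () , _
  ... | suc k , s≤s i<k , s≤s k<j , ek = k , i<k , k<j , ek

  between-cons : ∀ {c w} → c ≢ a → Between w a b → Between (c ∷ w) a b
  between-cons c≢a bt zero _ _ ei _ = ⊥-elim (c≢a ei)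
  between-cons c≢a bt (suc i) (suc j) (s≤s i<j) ei ej with bt i j i<j ei ej
  ... | k , i<k , k<j , ek = suc k , s≤s i<k , s≤s k<j , ek

  guarded-cons : ∀ {c w} → c ≢ a → Guarded w → Guarded (c ∷ w)
  guarded-cons c≢a g zero ei = ⊥-elim (c≢a ei)
  guarded-cons c≢a g (suc i) ei with g i ei
  ... | k , k<i , ek = suc k , s≤s k<i , ek

  guarded-tail : ∀ {c w} → c ≢ b → Guarded (c ∷ w) → Guarded w
  guarded-tail c≢b g i ei with g (suc i) ei
  ... | zero , _ , ek = ⊥-elim (c≢b ek)
  ... | suc k , s≤s k<i , ek = k , k<i , ek

  guarded-after-b : ∀ {w} → b ≢ a → Guarded (b ∷ w)
  guarded-after-b b≢a zero ei = ⊥-elim (b≢a ei)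
  guarded-after-b b≢a (suc i) _ = zero , s≤s z≤n , refl

  guarded-after-a : ∀ {w} → Between (a ∷ w) a b → Guarded w
  guarded-after-a bt i ei with bt zero (suc i) (s≤s z≤n) refl ei
  ... | zero , () , _
  ... | suc k , _ , s≤s k<i , ek = k , k<i , ek

  between-after-a : ∀ {w} → Between w a b → Guarded w → Between (a ∷ w) a b
  between-after-a bt g zero (suc j) _ _ ej with g j ej
  ... | k , k<j , ek = suc k , s≤s z≤n , s≤s k<j , ek
  between-after-a bt g (suc i) (suc j) (s≤s i<j) ei ej with bt i j i<j ei ej
  ... | k , i<k , k<j , ek = suc k , s≤s i<k , s≤s k<j , ek

  sound : ∀ s w → Valid s w → Accepted (scan s w)
  sound s [] _ = accepted
  sound s (c ∷ w) v with role c | spec c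
  sound idle (c ∷ w) bt | isA | isA refl = sound pending w (between-tail bt , guarded-after-a bt)
  sound pending (c ∷ w) (_ , g) | isA | isA refl with g zero refl
  ... | _ , () , _
  sound s (c ∷ w) v | isB | _ = sound idle w (between-tail (between-of v))
  sound idle (c ∷ w) bt | other | _ = sound idle w (between-tail bt)
  sound pending (c ∷ w) (bt , g) | other | other _ c≢b = sound pending w (between-tail bt , guarded-tail c≢b g)

  complete : ∀ s w → Accepted (scan s w) → Valid s w
  complete idle [] _ = λ ()
  complete pending [] _ = (λ ()) , λ ()
  complete s (c ∷ w) ok with role c | spec c
  complete idle (c ∷ w) ok | isA | isA refl with complete pending w ok
  ... | bt , g = between-after-a bt g
  complete pending (c ∷ w) () | isA | _
  complete idle (c ∷ w) ok | isB | isB c≢a refl = between-cons c≢a (complete idle w ok)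
  complete pending (c ∷ w) ok | isB | isB c≢a refl =
    between-cons c≢a (complete idle w ok) , guarded-after-b c≢a
  complete idle (c ∷ w) ok | other | other c≢a _ = between-cons c≢a (complete idle w ok)
  complete pending (c ∷ w) ok | other | other c≢a _ with complete pending w ok
  ... | bt , g = between-cons c≢a bt , guarded-cons c≢a g

  accepted-a-free : ∀ s w → count a w ≡ 0 → Accepted (scan s w)
  accepted-a-free s [] _ = accepted
  accepted-a-free s (c ∷ w) h with role c | spec c
  ... | isA | isA refl = ⊥-elim (1+n≢0 (trans (sym (count-here a w)) h))
  ... | isB | isB c≢a _ = accepted-a-free idle w (trans (sym (count-there w c≢a)) h)
  ... | other | other c≢a _ = accepted-a-free s w (trans (sym (count-there w c≢a)) h)

  idle-a-free : ∀ w → count a w ≡ 0 → scan idle w ≡ just idle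
  idle-a-free [] _ = refl
  idle-a-free (c ∷ w) h with role c | spec c
  ... | isA | isA refl = ⊥-elim (1+n≢0 (trans (sym (count-here a w)) h))
  ... | isB | isB c≢a _ = idle-a-free w (trans (sym (count-there w c≢a)) h)
  ... | other | other c≢a _ = idle-a-free w (trans (sym (count-there w c≢a)) h)

  accepted-one-a : ∀ w → count a w ≤ 1 → Accepted (scan idle w)
  accepted-one-a [] _ = accepted
  accepted-one-a (c ∷ w) h with role c | spec c
  ... | isA | isA refl =
    accepted-a-free pending w (n≤0⇒n≡0 (s≤s⁻¹ (subst (_≤ 1) (count-here a w) h)))
  ... | isB | isB c≢a _ = accepted-one-a w (subst (_≤ 1) (count-there w c≢a) h)
  ... | other | other c≢a _ = accepted-one-a w (subst (_≤ 1) (count-there w c≢a) h)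

  between-around : a ≢ b → ∀ P S → count a P ≡ 0 → count a S ≡ 0 → Between (P ++ a ∷ b ∷ a ∷ S) a b
  between-around a≢b P S hP hS =
    complete idle (P ++ a ∷ b ∷ a ∷ S) (subst Accepted (sym scan≡) (accepted-a-free pending S hS))
    where
    open ≡-Reasoning
    scan≡ : scan idle (P ++ a ∷ b ∷ a ∷ S) ≡ scan pending S
    scan≡ = begin
      scan idle (P ++ a ∷ b ∷ a ∷ S)        ≡⟨ scan-++ idle P _ ⟩
      resume (scan idle P) (a ∷ b ∷ a ∷ S)  ≡⟨ cong (λ m → resume m (a ∷ b ∷ a ∷ S)) (idle-a-free P hP) ⟩
      scan idle (a ∷ b ∷ a ∷ S)             ≡⟨ scan-a idle _ ⟩
      scan pending (b ∷ a ∷ S)              ≡⟨ scan-b a≢b pending _ ⟩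
      scan idle (a ∷ S)                     ≡⟨ scan-a idle S ⟩
      scan pending S                        ∎

  between-sparse : a ≢ b → ∀ P S → count a P ≤ 1 → count a S ≤ 1 → Between (P ++ b ∷ a ∷ b ∷ S) a b
  between-sparse a≢b P S hP hS =
    complete idle (P ++ b ∷ a ∷ b ∷ S) (subst Accepted (sym (scan-++ idle P _)) (after P (accepted-one-a P hP)))
    where
    open ≡-Reasoning
    scan≡ : ∀ s → scan s (b ∷ a ∷ b ∷ S) ≡ scan idle S
    scan≡ s = begin
      scan s (b ∷ a ∷ b ∷ S)    ≡⟨ scan-b a≢b s _ ⟩
      scan idle (a ∷ b ∷ S)     ≡⟨ scan-a idle _ ⟩
      scan pending (b ∷ S)      ≡⟨ scan-b a≢b pending S ⟩
      scan idle S               ∎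
    after : ∀ P → Accepted (scan idle P) → Accepted (resume (scan idle P) (b ∷ a ∷ b ∷ S))
    after P ok with scan idle P
    after P accepted | just s = subst Accepted (sym (scan≡ s)) (accepted-one-a S hS)

  b-before-a : ∀ m r → Accepted (scan pending (m ++ a ∷ r)) → b ∈ m
  b-before-a [] r ok with () ← subst Accepted (scan-a pending r) ok
  b-before-a (c ∷ m) r ok with role c | spec c
  b-before-a (c ∷ m) r () | isA | _
  ... | isB | isB _ refl = here refl
  ... | other | _ = there (b-before-a m r ok)

  between-consecutive : ∀ m₁ m r → Between (m₁ ++ a ∷ m ++ a ∷ r) a b → b ∈ m
  between-consecutive m₁ m r bt =
    after (scan idle m₁) (subst Accepted (scan-++ idle m₁ _) (sound idle (m₁ ++ a ∷ m ++ a ∷ r) bt))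
    where
    after : ∀ s₁ → Accepted (resume s₁ (a ∷ m ++ a ∷ r)) → b ∈ m
    after (just idle) ok = b-before-a m r (subst Accepted (scan-a idle _) ok)
    after (just pending) ok with () ← subst Accepted (scan-a pending _) ok

  between-erase : ∀ {z} → z ≢ a → z ≢ b → ∀ w → Between (erase z w) a b → Between w a b
  between-erase {z} z≢a z≢b w bt =
    complete idle w (subst Accepted (scan-erase z≢a z≢b idle w) (sound idle (erase z w) bt))

  between-unerase : ∀ {z} → z ≢ a → z ≢ b → ∀ w → Between w a b → Between (erase z w) a b
  between-unerase z≢a z≢b w bt =
    complete idle (erase _ w) (subst Accepted (sym (scan-erase z≢a z≢b idle w)) (sound idle w bt))

  between? : ∀ w → Dec (Between w a b)
  between? w = map′ (complete idle w) (sound idle w) (accepted? (scan idle w))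
    where
    accepted? : ∀ m → Dec (Accepted m)
    accepted? nothing = no λ ()
    accepted? (just _) = yes accepted

-- 123-patterns with respect to a labeling ℓ, seen as subsequences.
module Patterns {n : ℕ} (ℓ : Fin n → ℕ) where

  Has123 : Word n → Set
  Has123 w = ∃[ p ] ∃[ q ] ∃[ r ] ((p ∷ q ∷ r ∷ []) ⊆ w × ℓ p < ℓ q × ℓ q < ℓ r)

  has123-⊆ : ∀ {u w} → u ⊆ w → Has123 u → Has123 w
  has123-⊆ u⊆w (p , q , r , τ , p<q , q<r) = p , q , r , ⊆-trans τ u⊆w , p<q , q<r

  positions⇒⊆ : ∀ (w : Word n) (i j k : Pos w) → i Fin.< j → j Fin.< k →
    lookup w i ∷ lookup w j ∷ lookup w k ∷ [] ⊆ w
  positions⇒⊆ (x ∷ w) zero (suc j) (suc k) _ (s≤s j<k) = refl ∷ pair j k j<k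
    where
    pair : ∀ {w : Word n} (j k : Pos w) → j Fin.< k → lookup w j ∷ lookup w k ∷ [] ⊆ w
    pair {y ∷ w} zero (suc k) _ = refl ∷ from∈ (∈-lookup k)
    pair {y ∷ w} (suc j) (suc k) (s≤s j<k) = y ∷ʳ pair j k j<k
  positions⇒⊆ (x ∷ w) (suc i) (suc j) (suc k) (s≤s i<j) (s≤s j<k) = x ∷ʳ positions⇒⊆ w i j k i<j j<k

  ⊆⇒positions : ∀ {p q r} {w : Word n} → p ∷ q ∷ r ∷ [] ⊆ w →
    ∃[ i ] ∃[ j ] ∃[ k ] (i Fin.< j × j Fin.< k × lookup w i ≡ p × lookup w j ≡ q × lookup w k ≡ r)
  ⊆⇒positions (_ ∷ʳ τ) with ⊆⇒positions τ
  ... | i , j , k , i<j , j<k , eᵢ , eⱼ , eₖ = suc i , suc j , suc k , s≤s i<j , s≤s j<k , eᵢ , eⱼ , eₖ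
  ⊆⇒positions (refl ∷ τ) with pair τ
    where
    pair : ∀ {q r} {w : Word n} → q ∷ r ∷ [] ⊆ w → ∃[ j ] ∃[ k ] (j Fin.< k × lookup w j ≡ q × lookup w k ≡ r)
    pair (_ ∷ʳ σ) with pair σ
    ... | j , k , j<k , eⱼ , eₖ = suc j , suc k , s≤s j<k , eⱼ , eₖ
    pair (refl ∷ σ) = zero , suc (index (to∈ σ)) , s≤s z≤n , refl , sym (Any.lookup-index (to∈ σ))
  ... | j , k , j<k , eⱼ , eₖ = zero , suc j , suc k , s≤s z≤n , s≤s j<k , refl , eⱼ , eₖ

  avoids⇒¬has123 : ∀ w → Avoids123 ℓ w → ¬ Has123 w
  avoids⇒¬has123 w avoids (p , q , r , τ , p<q , q<r) with ⊆⇒positions τ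
  ... | i , j , k , i<j , j<k , refl , refl , refl = avoids (i , j , k , i<j , j<k , p<q , q<r)

  ¬has123⇒avoids : ∀ w → ¬ Has123 w → Avoids123 ℓ w
  ¬has123⇒avoids w free (i , j , k , i<j , j<k , p<q , q<r) =
    free (lookup w i , lookup w j , lookup w k , positions⇒⊆ w i j k i<j j<k , p<q , q<r)

  Below : Fin n → Word n → Set
  Below c u = Any (λ a → ℓ a < ℓ c) u

  Above : Fin n → Word n → Set
  Above c v = Any (λ b → ℓ c < ℓ b) v

  middle : ∀ {c u v} → Below c u → Above c v → Has123 (u ++ c ∷ v)
  middle {c} below above with find below | find above
  ... | a , a∈u , a<c | b , b∈v , c<b = a , c , b , ++⁺ (from∈ a∈u) (refl ∷ from∈ b∈v) , a<c , c<b

  ⊆-insert : ∀ {A : Set} {xs u v} {c : A} → xs ⊆ u ++ c ∷ v →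
    xs ⊆ u ++ v ⊎ ∃[ ys ] ∃[ zs ] (xs ≡ ys ++ c ∷ zs × ys ⊆ u × zs ⊆ v)
  ⊆-insert {u = []} (_ ∷ʳ τ) = inj₁ τ
  ⊆-insert {u = []} (refl ∷ τ) = inj₂ ([] , _ , refl , [] , τ)
  ⊆-insert {u = d ∷ u} (_ ∷ʳ τ) with ⊆-insert {u = u} τ
  ... | inj₁ σ = inj₁ (d ∷ʳ σ)
  ... | inj₂ (ys , zs , eq , σ₁ , σ₂) = inj₂ (ys , zs , eq , d ∷ʳ σ₁ , σ₂)
  ⊆-insert {u = d ∷ u} (refl ∷ τ) with ⊆-insert {u = u} τ
  ... | inj₁ σ = inj₁ (refl ∷ σ)
  ... | inj₂ (ys , zs , refl , σ₁ , σ₂) = inj₂ (d ∷ ys , zs , refl , refl ∷ σ₁ , σ₂)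

  -- Insertion lemma: a new copy of c, placed between two old copies, creates a 123
  -- only as its middle letter (as first or last letter an old copy would do).
  insert-copy : ∀ {c} U V → ¬ Has123 (U ++ V) → c ∈ U → c ∈ V →
    ¬ (Below c U × Above c V) → ¬ Has123 (U ++ c ∷ V)
  insert-copy {c} U V free c∈U c∈V ¬middle (p , q , r , τ , p<q , q<r) with ⊆-insert {u = U} τ
  ... | inj₁ σ = free (p , q , r , σ , p<q , q<r)
  ... | inj₂ ([] , _ , refl , _ , σ) = free (c , q , r , ++⁺ (from∈ c∈U) σ , p<q , q<r)
  ... | inj₂ (_ ∷ [] , _ , refl , σ₁ , σ₂) = ¬middle (lose (to∈ σ₁) p<q , lose (to∈ σ₂) q<r)
  ... | inj₂ (_ ∷ _ ∷ [] , _ , refl , σ , _) = free (p , q , c , ++⁺ σ (from∈ c∈V) , p<q , q<r)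
  ... | inj₂ (_ ∷ _ ∷ _ ∷ [] , _ , () , _)
  ... | inj₂ (_ ∷ _ ∷ _ ∷ _ ∷ _ , _ , () , _)

module ThreeOccurrences {n : ℕ} (ℓ : Fin n → ℕ) (inj : Injective _≡_ _≡_ ℓ) where
  open Patterns ℓ

  ordered-pair-123 : ∀ {x s t : Fin n} a₁ a₂ a₃ a₄ → s ∈ a₂ → t ∈ a₃ → ℓ s < ℓ t →
    ℓ x ≢ ℓ s → ℓ x ≢ ℓ t → Has123 (a₁ ++ x ∷ a₂ ++ x ∷ a₃ ++ x ∷ a₄)
  ordered-pair-123 {x} {s} {t} a₁ a₂ a₃ a₄ s∈a₂ t∈a₃ s<t x≢s x≢t with <-cmp (ℓ x) (ℓ s) | <-cmp (ℓ x) (ℓ t)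
  ... | tri≈ _ x≡s _ | _ = ⊥-elim (x≢s x≡s)
  ... | _ | tri≈ _ x≡t _ = ⊥-elim (x≢t x≡t)
  ... | tri< x<s _ _ | _ =
    x , s , t , ++⁺ˡ a₁ (refl ∷ ++⁺ (from∈ s∈a₂) (x ∷ʳ ++⁺ʳ (x ∷ a₄) (from∈ t∈a₃))) , x<s , s<t
  ... | tri> _ _ s<x | tri< x<t _ _ =
    s , x , t , ++⁺ˡ a₁ (x ∷ʳ ++⁺ (from∈ s∈a₂) (refl ∷ ++⁺ʳ (x ∷ a₄) (from∈ t∈a₃))) , s<x , x<t
  ... | tri> _ _ _ | tri> _ _ t<x =
    s , t , x , ++⁺ˡ a₁ (x ∷ʳ ++⁺ (from∈ s∈a₂) (x ∷ʳ ++⁺ (from∈ t∈a₃) (refl ∷ minimum a₄))) , s<t , t<x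

  label-≢ : ∀ {a b : Fin n} → a ≢ b → ℓ a ≢ ℓ b
  label-≢ a≢b ℓa≡ℓb = a≢b (inj ℓa≡ℓb)

  two-letters-123 : ∀ {x s t : Fin n} a₁ a₂ a₃ a₄ → s ∈ a₂ → s ∈ a₃ → t ∈ a₂ → t ∈ a₃ →
    s ≢ x → t ≢ x → s ≢ t → Has123 (a₁ ++ x ∷ a₂ ++ x ∷ a₃ ++ x ∷ a₄)
  two-letters-123 {x} {s} {t} a₁ a₂ a₃ a₄ s∈a₂ s∈a₃ t∈a₂ t∈a₃ s≢x t≢x s≢t with <-cmp (ℓ s) (ℓ t)
  ... | tri< s<t _ _ = ordered-pair-123 a₁ a₂ a₃ a₄ s∈a₂ t∈a₃ s<t (label-≢ (≢-sym s≢x)) (label-≢ (≢-sym t≢x))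
  ... | tri≈ _ s≡t _ = ⊥-elim (label-≢ s≢t s≡t)
  ... | tri> _ _ t<s = ordered-pair-123 a₁ a₂ a₃ a₄ t∈a₂ s∈a₃ t<s (label-≢ (≢-sym t≢x)) (label-≢ (≢-sym s≢x))

  partner-between : ∀ {x y : Fin n} a₁ a₂ a₃ a₄ → Alternate (a₁ ++ x ∷ a₂ ++ x ∷ a₃ ++ x ∷ a₄) x y →
    y ∈ a₂ × y ∈ a₃
  partner-between {x} {y} a₁ a₂ a₃ a₄ (bt , _) =
    Scan.between-consecutive x y a₁ a₂ (a₃ ++ x ∷ a₄) bt ,
    Scan.between-consecutive x y (a₁ ++ x ∷ a₂) a₃ a₄ (subst (λ w → Between w x y) reassoc bt)
    where
    reassoc : a₁ ++ x ∷ a₂ ++ x ∷ a₃ ++ x ∷ a₄ ≡ (a₁ ++ x ∷ a₂) ++ x ∷ a₃ ++ x ∷ a₄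
    reassoc = sym (++-assoc a₁ (x ∷ a₂) (x ∷ a₃ ++ x ∷ a₄))

  unique-partner : ∀ {x y : Fin n} w → ¬ Has123 w → 3 ≤ count x w → y ≢ x → Alternate w x y →
    ∀ t → t ≢ x → Alternate w x t → t ≡ y
  unique-partner {x} {y} w free three y≢x alt-y t t≢x alt-t with three-occurrences x w three
  ... | a₁ , a₂ , a₃ , a₄ , refl with t ≟ y
  ...   | yes t≡y = t≡y
  ...   | no t≢y =
    ⊥-elim (free (two-letters-123 a₁ a₂ a₃ a₄ (proj₁ y-in) (proj₂ y-in) (proj₁ t-in) (proj₂ t-in)
                   y≢x t≢x (≢-sym t≢y)))
    where
    y-in = partner-between {x} {y} a₁ a₂ a₃ a₄ alt-y
    t-in = partner-between {x} {t} a₁ a₂ a₃ a₄ alt-t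

module _ {n : ℕ} where

  cut-early : ∀ {x y : Fin n} a₁ a₂ a₃ a₄ → y ∈ a₂ → y ∈ a₃ →
    ∃[ u ] ∃[ v ] (a₁ ++ x ∷ a₂ ++ x ∷ a₃ ++ x ∷ a₄ ≡ u ++ y ∷ v × x ∈ u × (x ∷ y ∷ []) ⊆ v)
  cut-early {x} {y} a₁ a₂ a₃ a₄ y∈a₂ y∈a₃ with ∈-∃++ y∈a₂
  ... | b₁ , b₂ , refl = a₁ ++ x ∷ b₁ , b₂ ++ x ∷ r , regroup , ∈-++⁺ʳ a₁ (here refl) ,
                         ++⁺ˡ b₂ (refl ∷ ++⁺ʳ (x ∷ a₄) (from∈ y∈a₃))
    where
    r = a₃ ++ x ∷ a₄
    regroup : a₁ ++ x ∷ (b₁ ++ y ∷ b₂) ++ x ∷ r ≡ (a₁ ++ x ∷ b₁) ++ y ∷ b₂ ++ x ∷ r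
    regroup = trans (cong (λ z → a₁ ++ x ∷ z) (++-assoc b₁ (y ∷ b₂) (x ∷ r)))
                    (sym (++-assoc a₁ (x ∷ b₁) (y ∷ b₂ ++ x ∷ r)))

  cut-late : ∀ {x y : Fin n} a₁ a₂ a₃ a₄ → y ∈ a₂ → y ∈ a₃ →
    ∃[ u ] ∃[ v ] (a₁ ++ x ∷ a₂ ++ x ∷ a₃ ++ x ∷ a₄ ≡ u ++ y ∷ v × (y ∷ x ∷ []) ⊆ u × x ∈ v)
  cut-late {x} {y} a₁ a₂ a₃ a₄ y∈a₂ y∈a₃ with ∈-∃++ y∈a₃
  ... | c₁ , c₂ , refl = l ++ x ∷ c₁ , c₂ ++ x ∷ a₄ , regroup ,
                         ++⁺ (from∈ (∈-++⁺ʳ a₁ (there y∈a₂))) (refl ∷ minimum c₁) , ∈-++⁺ʳ c₂ (here refl)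
    where
    l = a₁ ++ x ∷ a₂
    regroup : a₁ ++ x ∷ a₂ ++ x ∷ (c₁ ++ y ∷ c₂) ++ x ∷ a₄ ≡ (l ++ x ∷ c₁) ++ y ∷ c₂ ++ x ∷ a₄
    regroup = begin
      a₁ ++ x ∷ a₂ ++ x ∷ (c₁ ++ y ∷ c₂) ++ x ∷ a₄
        ≡⟨ cong (λ z → a₁ ++ x ∷ a₂ ++ x ∷ z) (++-assoc c₁ (y ∷ c₂) (x ∷ a₄)) ⟩
      a₁ ++ x ∷ a₂ ++ x ∷ c₁ ++ y ∷ c₂ ++ x ∷ a₄
        ≡⟨ sym (++-assoc a₁ (x ∷ a₂) (x ∷ c₁ ++ y ∷ c₂ ++ x ∷ a₄)) ⟩
      l ++ x ∷ c₁ ++ y ∷ c₂ ++ x ∷ a₄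
        ≡⟨ sym (++-assoc l (x ∷ c₁) (y ∷ c₂ ++ x ∷ a₄)) ⟩
      (l ++ x ∷ c₁) ++ y ∷ c₂ ++ x ∷ a₄
        ∎
      where open ≡-Reasoning

module _ {n : ℕ} where

  erase-idem : ∀ (z : Fin n) w → erase z (erase z w) ≡ erase z w
  erase-idem z w = erase-fresh z (erase z w) (count-erase-self z w)

  erase-wrap : ∀ (z : Fin n) P m S → count z P ≡ 0 → count z S ≡ 0 →
    erase z (P ++ m ++ S) ≡ P ++ erase z m ++ S
  erase-wrap z P m S hP hS = begin
    erase z (P ++ m ++ S)                ≡⟨ erase-++ z P (m ++ S) ⟩
    erase z P ++ erase z (m ++ S)        ≡⟨ cong₂ _++_ (erase-fresh z P hP) (erase-++ z m S) ⟩
    P ++ erase z m ++ erase z S          ≡⟨ cong (λ e → P ++ erase z m ++ e) (erase-fresh z S hS) ⟩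
    P ++ erase z m ++ S                  ∎
    where open ≡-Reasoning

  collapse : Fin n → Word n → Word n → Word n
  collapse x u v = erase x u ++ x ∷ x ∷ erase x v

  wrap : Fin n → Fin n → Word n → Word n → Word n
  wrap x y u v = erase x u ++ x ∷ y ∷ x ∷ erase x v

  interleave : Fin n → Fin n → Word n → Word n → Word n
  interleave x y u v = erase y (erase x u) ++ x ∷ y ∷ x ∷ y ∷ erase y (erase x v)

  ∈-wrap : ∀ {t} (z : Fin n) u v m → t ≢ z → t ∈ u ++ v → t ∈ erase z u ++ m ++ erase z v
  ∈-wrap z u v m t≢z t∈uv with ∈-++⁻ u t∈uv
  ... | inj₁ t∈u = ∈-++⁺ˡ (∈-erase z u t≢z t∈u)
  ... | inj₂ t∈v = ∈-++⁺ʳ (erase z u) (∈-++⁺ʳ m (∈-erase z v t≢z t∈v))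

  ∈-skip : ∀ {t c : Fin n} u v → t ≢ c → t ∈ u ++ c ∷ v → t ∈ u ++ v
  ∈-skip u v t≢c t∈w with ∈-++⁻ u t∈w
  ... | inj₁ t∈u = ∈-++⁺ˡ t∈u
  ... | inj₂ (here t≡c) = ⊥-elim (t≢c t≡c)
  ... | inj₂ (there t∈v) = ∈-++⁺ʳ u t∈v

  alternate-erase : ∀ {z a b : Fin n} → z ≢ a → z ≢ b → ∀ w → Alternate (erase z w) a b → Alternate w a b
  alternate-erase z≢a z≢b w (ab , ba) =
    Scan.between-erase _ _ z≢a z≢b w ab , Scan.between-erase _ _ z≢b z≢a w ba

  alternate-unerase : ∀ {z a b : Fin n} → z ≢ a → z ≢ b → ∀ w → Alternate w a b → Alternate (erase z w) a b
  alternate-unerase z≢a z≢b w (ab , ba) =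
    Scan.between-unerase _ _ z≢a z≢b w ab , Scan.between-unerase _ _ z≢b z≢a w ba

module Representation {n : ℕ} (G : SimpleGraph n) where

  Correct : Word n → Fin n → Fin n → Set
  Correct w a b = (Alternate w a b → Adj G a b) × (Adj G a b → Alternate w a b)

  correct-sym : ∀ {w a b} → Correct w a b → Correct w b a
  correct-sym (alt⇒adj , adj⇒alt) =
    (λ alt → SimpleGraph.sym G (alt⇒adj (swap alt))) , (λ adj → swap (adj⇒alt (SimpleGraph.sym G adj)))

  correct-transfer : ∀ {z a b} → z ≢ a → z ≢ b → ∀ w w′ → erase z w ≡ erase z w′ →
    Correct w a b → Correct w′ a b
  correct-transfer z≢a z≢b w w′ eq (alt⇒adj , adj⇒alt) =
    (λ alt → alt⇒adj (alternate-erase z≢a z≢b w (subst (λ e → Alternate e _ _) (sym eq)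
                        (alternate-unerase z≢a z≢b w′ alt)))) ,
    (λ adj → alternate-erase z≢a z≢b w′ (subst (λ e → Alternate e _ _) eq
                        (alternate-unerase z≢a z≢b w (adj⇒alt adj))))

  pairs-through : ∀ {w′} x → (∀ t → t ≢ x → Correct w′ x t) →
    (∀ a b → a ≢ x → b ≢ x → a ≢ b → Correct w′ a b) → ∀ a b → a ≢ b → Correct w′ a b
  pairs-through {w′} x through avoiding a b a≢b with a ≟ x | b ≟ x
  ... | yes refl | yes refl = ⊥-elim (a≢b refl)
  ... | yes refl | no b≢x = through b b≢x
  ... | no a≢x | yes refl = correct-sym {w′} (through a a≢x)
  ... | no a≢x | no b≢x = avoiding a b a≢x b≢x a≢b

  represents-collapse : ∀ {x} u v → Represents G (u ++ x ∷ v) →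
    (∀ t → t ≢ x → ¬ Alternate (u ++ x ∷ v) x t) → Represents G (collapse x u v)
  represents-collapse {x} u v (letters , pairs) isolated = letters′ , pairs-through {collapse x u v} x through avoiding
    where
    w′ = collapse x u v

    letters′ : ∀ t → t ∈ w′
    letters′ t with t ≟ x
    ... | yes refl = ∈-++⁺ʳ (erase x u) (here refl)
    ... | no t≢x = ∈-wrap x u v (x ∷ x ∷ []) t≢x (∈-skip u v t≢x (letters t))

    through : ∀ t → t ≢ x → Correct w′ x t
    through t t≢x =
      (λ alt → case Scan.between-consecutive x t (erase x u) [] (erase x v) (proj₁ alt) of λ ()) ,
      (λ adj → ⊥-elim (isolated t t≢x (proj₂ (pairs x t (≢-sym t≢x)) adj)))

    same-erasure : erase x (u ++ x ∷ v) ≡ erase x w′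
    same-erasure = begin
      erase x (u ++ x ∷ v)                       ≡⟨ erase-++ x u (x ∷ v) ⟩
      erase x u ++ erase x (x ∷ v)               ≡⟨ cong (erase x u ++_) (erase-here x v) ⟩
      erase x u ++ erase x v                     ≡⟨ cong (λ m → erase x u ++ m ++ erase x v) erase-middle ⟩
      erase x u ++ erase x (x ∷ x ∷ []) ++ erase x v
        ≡⟨ sym (erase-wrap x (erase x u) (x ∷ x ∷ []) (erase x v) (count-erase-self x u) (count-erase-self x v)) ⟩
      erase x w′                                 ∎
      where
      open ≡-Reasoning
      erase-middle : [] ≡ erase x (x ∷ x ∷ [])
      erase-middle = sym (trans (erase-here x (x ∷ [])) (erase-here x []))

    avoiding : ∀ a b → a ≢ x → b ≢ x → a ≢ b → Correct w′ a b
    avoiding a b a≢x b≢x a≢b =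
      correct-transfer (≢-sym a≢x) (≢-sym b≢x) (u ++ x ∷ v) w′ same-erasure (pairs a b a≢b)

  represents-wrap : ∀ {x y} u v → x ≢ y → Represents G (u ++ y ∷ v) → count y u ≤ 1 → count y v ≤ 1 →
    Alternate (u ++ y ∷ v) x y → (∀ t → t ≢ x → Alternate (u ++ y ∷ v) x t → t ≡ y) →
    Represents G (wrap x y u v)
  represents-wrap {x} {y} u v x≢y (letters , pairs) y-in-u y-in-v alt partner =
    letters′ , pairs-through {wrap x y u v} x through avoiding
    where
    w′ = wrap x y u v

    letters′ : ∀ t → t ∈ w′
    letters′ t with t ≟ x | t ≟ y
    ... | yes refl | _ = ∈-++⁺ʳ (erase x u) (here refl)
    ... | no _ | yes refl = ∈-++⁺ʳ (erase x u) (there (here refl))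
    ... | no t≢x | no t≢y = ∈-wrap x u v (x ∷ y ∷ x ∷ []) t≢x (∈-skip u v t≢y (letters t))

    alternates : Alternate w′ x y
    alternates =
      Scan.between-around x y x≢y (erase x u) (erase x v) (count-erase-self x u) (count-erase-self x v) ,
      Scan.between-sparse y x (≢-sym x≢y) (erase x u) (erase x v)
        (subst (_≤ 1) (sym (count-erase-other x u (≢-sym x≢y))) y-in-u)
        (subst (_≤ 1) (sym (count-erase-other x v (≢-sym x≢y))) y-in-v)

    through : ∀ t → t ≢ x → Correct w′ x t
    through t t≢x with t ≟ y
    ... | yes refl = (λ _ → proj₁ (pairs x t x≢y) alt) , (λ _ → alternates)
    ... | no t≢y =
      (λ alt′ → ⊥-elim (t≢y (only-y
                  (Scan.between-consecutive x t (erase x u) (y ∷ []) (erase x v) (proj₁ alt′))))) ,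
      (λ adj → ⊥-elim (t≢y (partner t t≢x (proj₂ (pairs x t (≢-sym t≢x)) adj))))
      where
      only-y : t ∈ y ∷ [] → t ≡ y
      only-y (here t≡y) = t≡y

    same-erasure : erase x (u ++ y ∷ v) ≡ erase x w′
    same-erasure = begin
      erase x (u ++ y ∷ v)                   ≡⟨ erase-++ x u (y ∷ v) ⟩
      erase x u ++ erase x (y ∷ v)           ≡⟨ cong (erase x u ++_) (erase-there v (≢-sym x≢y)) ⟩
      erase x u ++ y ∷ erase x v             ≡⟨ cong (λ m → erase x u ++ m ++ erase x v) erase-middle ⟩
      erase x u ++ erase x (x ∷ y ∷ x ∷ []) ++ erase x v
        ≡⟨ sym (erase-wrap x (erase x u) (x ∷ y ∷ x ∷ []) (erase x v) (count-erase-self x u) (count-erase-self x v)) ⟩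
      erase x w′                             ∎
      where
      open ≡-Reasoning
      erase-middle : y ∷ [] ≡ erase x (x ∷ y ∷ x ∷ [])
      erase-middle = sym (trans (erase-here x _)
                       (trans (erase-there (x ∷ []) (≢-sym x≢y)) (cong (y ∷_) (erase-here x []))))

    avoiding : ∀ a b → a ≢ x → b ≢ x → a ≢ b → Correct w′ a b
    avoiding a b a≢x b≢x a≢b =
      correct-transfer (≢-sym a≢x) (≢-sym b≢x) (u ++ y ∷ v) w′ same-erasure (pairs a b a≢b)

  represents-interleave : ∀ {x y} u v → x ≢ y → Represents G (u ++ y ∷ v) →
    Alternate (u ++ y ∷ v) x y → (∀ t → t ≢ x → Alternate (u ++ y ∷ v) x t → t ≡ y) →
    (∀ t → t ≢ y → Alternate (u ++ y ∷ v) y t → t ≡ x) → Represents G (interleave x y u v)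
  represents-interleave {x} {y} u v x≢y (letters , pairs) alt partner-x partner-y =
    letters′ , pairs-through {interleave x y u v} x through-x avoiding-x
    where
    w = u ++ y ∷ v
    P = erase y (erase x u)
    S = erase y (erase x v)
    w′ = interleave x y u v

    x∉P : count x P ≡ 0
    x∉P = trans (count-erase-other y (erase x u) x≢y) (count-erase-self x u)
    x∉S : count x S ≡ 0
    x∉S = trans (count-erase-other y (erase x v) x≢y) (count-erase-self x v)
    y∉P : count y P ≡ 0
    y∉P = count-erase-self y (erase x u)
    y∉S : count y S ≡ 0
    y∉S = count-erase-self y (erase x v)

    reassoc : w′ ≡ (P ++ x ∷ []) ++ y ∷ x ∷ y ∷ S
    reassoc = sym (++-assoc P (x ∷ []) (y ∷ x ∷ y ∷ S))

    letters′ : ∀ t → t ∈ w′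
    letters′ t with t ≟ x | t ≟ y
    ... | yes refl | _ = ∈-++⁺ʳ P (here refl)
    ... | no _ | yes refl = ∈-++⁺ʳ P (there (here refl))
    ... | no t≢x | no t≢y =
      ∈-wrap y (erase x u) (erase x v) (x ∷ y ∷ x ∷ y ∷ []) t≢y
        (∈-wrap x u v [] t≢x (∈-skip u v t≢y (letters t)))

    alternates : Alternate w′ x y
    alternates =
      Scan.between-around x y x≢y P (y ∷ S) x∉P (trans (count-there S (≢-sym x≢y)) x∉S) ,
      subst (λ e → Between e y x) (sym reassoc)
        (Scan.between-around y x (≢-sym x≢y) (P ++ x ∷ []) S
          (trans (count-++ y P (x ∷ [])) (cong₂ _+_ y∉P (count-there [] x≢y))) y∉S)

    through-x : ∀ t → t ≢ x → Correct w′ x t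
    through-x t t≢x with t ≟ y
    ... | yes refl = (λ _ → proj₁ (pairs x t x≢y) alt) , (λ _ → alternates)
    ... | no t≢y =
      (λ alt′ → ⊥-elim (t≢y (only (Scan.between-consecutive x t P (y ∷ []) (y ∷ S) (proj₁ alt′))))) ,
      (λ adj → ⊥-elim (t≢y (partner-x t t≢x (proj₂ (pairs x t (≢-sym t≢x)) adj))))
      where
      only : t ∈ y ∷ [] → t ≡ y
      only (here t≡y) = t≡y

    through-y : ∀ t → t ≢ y → Correct w′ y t
    through-y t t≢y with t ≟ x
    ... | yes refl = correct-sym {w′} (through-x y (≢-sym x≢y))
    ... | no t≢x =
      (λ alt′ → ⊥-elim (t≢x (only (Scan.between-consecutive y t (P ++ x ∷ []) (x ∷ []) S
                                      (subst (λ e → Between e y t) reassoc (proj₁ alt′)))))) ,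
      (λ adj → ⊥-elim (t≢x (partner-y t t≢y (proj₂ (pairs y t (≢-sym t≢y)) adj))))
      where
      only : t ∈ x ∷ [] → t ≡ x
      only (here t≡x) = t≡x

    same-erasure : erase y (erase x w) ≡ erase y (erase x w′)
    same-erasure = begin
      erase y (erase x (u ++ y ∷ v))             ≡⟨ cong (erase y) (erase-++ x u (y ∷ v)) ⟩
      erase y (erase x u ++ erase x (y ∷ v))     ≡⟨ cong (λ e → erase y (erase x u ++ e)) (erase-there v (≢-sym x≢y)) ⟩
      erase y (erase x u ++ y ∷ erase x v)       ≡⟨ erase-++ y (erase x u) (y ∷ erase x v) ⟩
      P ++ erase y (y ∷ erase x v)               ≡⟨ cong (P ++_) (erase-here y (erase x v)) ⟩
      P ++ S                                     ≡⟨ cong (λ m → P ++ m ++ S) erase-yy ⟩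
      P ++ erase y (y ∷ y ∷ []) ++ S             ≡⟨ sym (erase-wrap y P (y ∷ y ∷ []) S y∉P y∉S) ⟩
      erase y (P ++ (y ∷ y ∷ []) ++ S)           ≡⟨ cong (λ m → erase y (P ++ m ++ S)) erase-xyxy ⟩
      erase y (P ++ erase x (x ∷ y ∷ x ∷ y ∷ []) ++ S)
        ≡⟨ cong (erase y) (sym (erase-wrap x P (x ∷ y ∷ x ∷ y ∷ []) S x∉P x∉S)) ⟩
      erase y (erase x w′)                       ∎
      where
      open ≡-Reasoning
      erase-yy : [] ≡ erase y (y ∷ y ∷ [])
      erase-yy = sym (trans (erase-here y _) (erase-here y []))
      erase-xyxy : y ∷ y ∷ [] ≡ erase x (x ∷ y ∷ x ∷ y ∷ [])
      erase-xyxy = sym (begin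
        erase x (x ∷ y ∷ x ∷ y ∷ [])   ≡⟨ erase-here x _ ⟩
        erase x (y ∷ x ∷ y ∷ [])       ≡⟨ erase-there _ (≢-sym x≢y) ⟩
        y ∷ erase x (x ∷ y ∷ [])       ≡⟨ cong (y ∷_) (erase-here x _) ⟩
        y ∷ erase x (y ∷ [])           ≡⟨ cong (y ∷_) (erase-there [] (≢-sym x≢y)) ⟩
        y ∷ y ∷ []                     ∎)

    untouched : ∀ a b → a ≢ x → b ≢ x → a ≢ y → b ≢ y → a ≢ b → Correct w′ a b
    untouched a b a≢x b≢x a≢y b≢y a≢b =
      correct-transfer x≢a x≢b (erase x w′) w′ (erase-idem x w′)
        (correct-transfer (≢-sym a≢y) (≢-sym b≢y) (erase x w) (erase x w′) same-erasure
          (correct-transfer x≢a x≢b w (erase x w) (sym (erase-idem x w)) (pairs a b a≢b)))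
      where
      x≢a = ≢-sym a≢x
      x≢b = ≢-sym b≢x

    avoiding-x : ∀ a b → a ≢ x → b ≢ x → a ≢ b → Correct w′ a b
    avoiding-x a b a≢x b≢x a≢b with a ≟ y | b ≟ y
    ... | yes refl | yes refl = ⊥-elim (a≢b refl)
    ... | yes refl | no b≢y = through-y b b≢y
    ... | no a≢y | yes refl = correct-sym {w′} (through-y a a≢y)
    ... | no a≢y | no b≢y = untouched a b a≢x b≢x a≢y b≢y a≢b

-- The rewrites preserve 123-avoidance: each is a subsequence of a word obtained by
-- inserting copies of x (and y) next to the chosen letter, one copy at a time.
module Insertions {n : ℕ} (ℓ : Fin n → ℕ) where
  open Patterns ℓ

  avoids-double : ∀ {x} u v → ¬ Has123 (u ++ x ∷ v) → x ∈ v → ¬ Has123 (u ++ x ∷ x ∷ v)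
  avoids-double {x} u v free x∈v has = insert-copy (u ++ x ∷ []) v free′ (∈-++⁺ʳ u (here refl)) x∈v ¬middle
    (subst Has123 (sym (++-assoc u (x ∷ []) (x ∷ v))) has)
    where
    free′ : ¬ Has123 ((u ++ x ∷ []) ++ v)
    free′ h = free (subst Has123 (++-assoc u (x ∷ []) v) h)
    ¬middle : ¬ (Below x (u ++ x ∷ []) × Above x v)
    ¬middle (below , above) with Any.++⁻ u below
    ... | inj₁ below-u = free (middle below-u above)
    ... | inj₂ (here x<x) = <-irrefl refl x<x

  avoids-flank : ∀ {x y} u v → ¬ Has123 (u ++ y ∷ v) → x ∈ u → x ∈ v →
    ¬ Below x (u ++ y ∷ []) ⊎ ¬ Above x (y ∷ v) → ¬ Has123 (u ++ x ∷ y ∷ x ∷ v)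
  avoids-flank {x} {y} u v free x∈u x∈v quiet =
    λ has → insert-copy (u ++ x ∷ y ∷ []) v one-copy′ (∈-++⁺ʳ u (here refl)) x∈v (¬middle₂ quiet)
      (subst Has123 (sym (++-assoc u (x ∷ y ∷ []) (x ∷ v))) has)
    where
    one-copy : ¬ Has123 (u ++ x ∷ y ∷ v)
    one-copy = insert-copy u (y ∷ v) free x∈u (there x∈v) (¬middle₁ quiet)
      where
      ¬middle₁ : ¬ Below x (u ++ y ∷ []) ⊎ ¬ Above x (y ∷ v) → ¬ (Below x u × Above x (y ∷ v))
      ¬middle₁ (inj₁ ¬below) (below , _) = ¬below (Any.++⁺ˡ below)
      ¬middle₁ (inj₂ ¬above) (_ , above) = ¬above above
    one-copy′ : ¬ Has123 ((u ++ x ∷ y ∷ []) ++ v)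
    one-copy′ h = one-copy (subst Has123 (++-assoc u (x ∷ y ∷ []) v) h)
    ¬middle₂ : ¬ Below x (u ++ y ∷ []) ⊎ ¬ Above x (y ∷ v) → ¬ (Below x (u ++ x ∷ y ∷ []) × Above x v)
    ¬middle₂ (inj₂ ¬above) (_ , above) = ¬above (there above)
    ¬middle₂ (inj₁ ¬below) (below , _) with Any.++⁻ u below
    ... | inj₁ below-u = ¬below (Any.++⁺ˡ below-u)
    ... | inj₂ (here x<x) = <-irrefl refl x<x
    ... | inj₂ (there (here y<x)) = ¬below (Any.++⁺ʳ u (here y<x))

  quiet-below : ∀ {x y} u v → ¬ Has123 (u ++ y ∷ v) → (x ∷ y ∷ []) ⊆ v → ℓ x < ℓ y → ¬ Below x (u ++ y ∷ [])
  quiet-below u v free τ x<y below with Any.++⁻ u below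
  ... | inj₁ below-u with find below-u
  ...   | a , a∈u , a<x = free (a , _ , _ , ++⁺ (from∈ a∈u) (_ ∷ʳ τ) , a<x , x<y)
  quiet-below u v free τ x<y below | inj₂ (here y<x) = <-asym x<y y<x

  quiet-above : ∀ {x y} u v → ¬ Has123 (u ++ y ∷ v) → (y ∷ x ∷ []) ⊆ u → ℓ y < ℓ x → ¬ Above x (y ∷ v)
  quiet-above u v free τ y<x (here x<y) = <-asym x<y y<x
  quiet-above u v free τ y<x (there above) with find above
  ... | b , b∈v , x<b = free (_ , _ , b , ++⁺ τ (_ ∷ʳ from∈ b∈v) , y<x , x<b)

  avoids-interleave : ∀ {x y} u v → ¬ Has123 (u ++ y ∷ v) → x ∈ u → (x ∷ y ∷ []) ⊆ v → ℓ x < ℓ y →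
    ¬ Has123 (u ++ x ∷ y ∷ x ∷ y ∷ v)
  avoids-interleave {x} {y} u v free x∈u τ x<y has =
    insert-copy (u ++ x ∷ y ∷ x ∷ []) v flanked (∈-++⁺ʳ u (there (here refl))) (to∈ (∷ˡ⁻ τ)) ¬middle
      (subst Has123 (sym (++-assoc u (x ∷ y ∷ x ∷ []) (y ∷ v))) has)
    where
    flanked : ¬ Has123 ((u ++ x ∷ y ∷ x ∷ []) ++ v)
    flanked h = avoids-flank u v free x∈u (to∈ τ) (inj₁ (quiet-below u v free τ x<y))
      (subst Has123 (++-assoc u (x ∷ y ∷ x ∷ []) v) h)
    ¬middle : ¬ (Below y (u ++ x ∷ y ∷ x ∷ []) × Above y v)
    ¬middle (_ , above) = free (middle (lose x∈u x<y) above)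

module Reduction {n : ℕ} (G : SimpleGraph n) (ℓ : Fin n → ℕ) (inj : Injective _≡_ _≡_ ℓ) where
  open Patterns ℓ
  open ThreeOccurrences ℓ inj
  open Insertions ℓ
  open Representation G

  Good : Word n → Set
  Good w = Represents G w × ¬ Has123 w

  Shorter : Word n → Set
  Shorter w = ∃[ w′ ] (length w′ < length w × Good w′)

  shorten-isolated : ∀ {x} w → Good w → 3 ≤ count x w → (∀ t → t ≢ x → ¬ Alternate w x t) → Shorter w
  shorten-isolated {x} w (rep , free) three isolated with three-occurrences x w three
  ... | a₁ , a₂ , a₃ , a₄ , refl =
    collapse x a₁ v ,
    shrink (erase x) (count x) (length-erase x) a₁ v (x ∷ x ∷ []) x two ,
    represents-collapse a₁ v rep isolated ,
    λ has → avoids-double a₁ v free (∈-++⁺ʳ a₂ (here refl))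
              (has123-⊆ (++⁺ (erase-⊆ x a₁) (refl ∷ refl ∷ erase-⊆ x v)) has)
    where
    v = a₂ ++ x ∷ a₃ ++ x ∷ a₄
    two : 2 ≤ count x a₁ + count x v
    two = s≤s⁻¹ (subst (3 ≤_) (count-split-self x a₁ v) three)

  shorten-wrap : ∀ {x y} w u v → w ≡ u ++ y ∷ v → Good w → x ≢ y → count y w ≤ 2 → 3 ≤ count x w →
    x ∈ u → x ∈ v → ¬ Below x (u ++ y ∷ []) ⊎ ¬ Above x (y ∷ v) →
    Alternate w x y → (∀ t → t ≢ x → Alternate w x t → t ≡ y) → Shorter w
  shorten-wrap {x} {y} _ u v refl (rep , free) x≢y few three x∈u x∈v quiet alt partner =
    wrap x y u v ,
    shrink (erase x) (count x) (length-erase x) u v (x ∷ y ∷ x ∷ []) y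
      (subst (3 ≤_) (count-split-other x y (≢-sym x≢y) u v) three) ,
    represents-wrap u v x≢y rep (≤-trans (m≤m+n _ _) ys) (≤-trans (m≤n+m _ _) ys) alt partner ,
    λ has → avoids-flank u v free x∈u x∈v quiet
              (has123-⊆ (++⁺ (erase-⊆ x u) (refl ∷ refl ∷ refl ∷ erase-⊆ x v)) has)
    where
    ys : count y u + count y v ≤ 1
    ys = s≤s⁻¹ (subst (_≤ 2) (count-split-self y u v) few)

  shorten-interleave : ∀ {x y} w u v → w ≡ u ++ y ∷ v → Good w → x ≢ y → 3 ≤ count x w → 3 ≤ count y w →
    x ∈ u → (x ∷ y ∷ []) ⊆ v → ℓ x < ℓ y → Alternate w x y →
    (∀ t → t ≢ x → Alternate w x t → t ≡ y) → (∀ t → t ≢ y → Alternate w y t → t ≡ x) → Shorter w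
  shorten-interleave {x} {y} _ u v refl (rep , free) x≢y xs ys x∈u τ x<y alt partner-x partner-y =
    interleave x y u v ,
    shrink (λ z → erase y (erase x z)) (λ z → count x z + count y z) (length-erase₂ x y x≢y)
      u v (x ∷ y ∷ x ∷ y ∷ []) y four ,
    represents-interleave u v x≢y rep alt partner-x partner-y ,
    λ has → avoids-interleave u v free x∈u τ x<y
              (has123-⊆ (++⁺ (thin u) (refl ∷ refl ∷ refl ∷ refl ∷ thin v)) has)
    where
    thin : ∀ z → erase y (erase x z) ⊆ z
    thin z = ⊆-trans (erase-⊆ y (erase x z)) (erase-⊆ x z)
    four : 4 ≤ (count x u + count y u) + (count x v + count y v)
    four = ≤-trans (≤-trans (n≤1+n 4)
                     (+-mono-≤ (subst (3 ≤_) (count-split-other x y (≢-sym x≢y) u v) xs)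
                               (s≤s⁻¹ (subst (3 ≤_) (count-split-self y u v) ys))))
                   (≤-reflexive (interchange (count x u) (count x v) (count y u) (count y v)))

  alternate? : ∀ (w : Word n) a b → Dec (Alternate w a b)
  alternate? w a b = Scan.between? a b w ×-dec Scan.between? b a w

  shorten-few : ∀ {x y} w → Good w → 3 ≤ count x w → y ≢ x → count y w ≤ 2 → Alternate w x y → Shorter w
  shorten-few {x} {y} w good@(_ , free) three y≢x few alt with three-occurrences x w three
  ... | a₁ , a₂ , a₃ , a₄ , refl with partner-between {x} {y} a₁ a₂ a₃ a₄ alt | <-cmp (ℓ x) (ℓ y)
  ...   | _ | tri≈ _ x≡y _ = ⊥-elim (label-≢ (≢-sym y≢x) x≡y)
  ...   | y∈a₂ , y∈a₃ | tri< x<y _ _ with cut-early {x = x} a₁ a₂ a₃ a₄ y∈a₂ y∈a₃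
  ...     | u , v , eq , x∈u , τ =
    shorten-wrap _ u v eq good (≢-sym y≢x) few three x∈u (to∈ τ)
      (inj₁ (quiet-below u v (subst (λ e → ¬ Has123 e) eq free) τ x<y)) alt partner
    where partner = unique-partner _ free three y≢x alt
  shorten-few {x} {y} w good@(_ , free) three y≢x few alt
    | a₁ , a₂ , a₃ , a₄ , refl | y∈a₂ , y∈a₃ | tri> _ _ y<x with cut-late {x = x} a₁ a₂ a₃ a₄ y∈a₂ y∈a₃
  ...     | u , v , eq , τ , x∈v =
    shorten-wrap _ u v eq good (≢-sym y≢x) few three (to∈ (∷ˡ⁻ τ)) x∈v
      (inj₂ (quiet-above u v (subst (λ e → ¬ Has123 e) eq free) τ y<x)) alt partner
    where partner = unique-partner _ free three y≢x alt

  shorten-many : ∀ {x y} w → Good w → 3 ≤ count x w → 3 ≤ count y w → y ≢ x → ℓ x < ℓ y →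
    Alternate w x y → Shorter w
  shorten-many {x} {y} w good@(_ , free) xs ys y≢x x<y alt with three-occurrences x w xs
  ... | a₁ , a₂ , a₃ , a₄ , refl with partner-between {x} {y} a₁ a₂ a₃ a₄ alt
  ...   | y∈a₂ , y∈a₃ with cut-early {x = x} a₁ a₂ a₃ a₄ y∈a₂ y∈a₃
  ...     | u , v , eq , x∈u , τ =
    shorten-interleave _ u v eq good (≢-sym y≢x) xs ys x∈u τ x<y alt
      (unique-partner _ free xs y≢x alt) (unique-partner _ free ys (≢-sym y≢x) (swap alt))

  shorten : ∀ (w : Word n) → Good w → ∀ x → 3 ≤ count x w → Shorter w
  shorten w good x three with any? (λ y → ¬? (y ≟ x) ×-dec alternate? w x y)
  ... | no none = shorten-isolated w good three (λ t t≢x alt → none (t , t≢x , alt))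
  ... | yes (y , y≢x , alt) with 3 ≤? count y w
  ...   | no few = shorten-few w good three y≢x (s≤s⁻¹ (≰⇒> few)) alt
  ...   | yes many with <-cmp (ℓ x) (ℓ y)
  ...     | tri< x<y _ _ = shorten-many w good three many y≢x x<y alt
  ...     | tri≈ _ x≡y _ = ⊥-elim (label-≢ (≢-sym y≢x) x≡y)
  ...     | tri> _ _ y<x = shorten-many w good many three (≢-sym y≢x) y<x (swap alt)

  reduce : ∀ (w : Word n) → Acc _<_ (length w) → Good w → ∃[ w′ ] (Good w′ × ((x : Fin n) → count x w′ ≤ 2))
  reduce w (acc smaller) good with any? (λ x → 3 ≤? count x w)
  ... | no none = w , good , λ x → s≤s⁻¹ (≰⇒> (λ three → none (x , three)))
  ... | yes (x , three) with shorten w good x three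
  ...   | w′ , shorter , good′ = reduce w′ (smaller shorter) good′

theorem3p4 : (n : ℕ) (G : SimpleGraph n) → Is123Representable G →
    Σ (Labeling n) λ ℓ → ∃[ w ] (Represents G w × Avoids123 (proj₁ ℓ) w × ((x : Fin n) → count x w ≤ 2))
theorem3p4 n G ((ℓ , inj) , w , represents , avoids)
  with Reduction.reduce G ℓ inj w (<-wellFounded (length w)) (represents , Patterns.avoids⇒¬has123 ℓ w avoids)
... | w′ , (represents′ , free′) , at-most-twice =
  (ℓ , inj) , w′ , represents′ , Patterns.¬has123⇒avoids ℓ w′ free′ , at-most-twice
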